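{- For every $N\in\mathbb N$, \[\sqrt N-1\leq D(N)\leq \frac{N+543443}{4}.\]
   Context: For $N\in\mathbb N$, $D(N)$ denotes the maximum size of a subset of $\{1,\dots,N\}$ containing no two distinct elements whose difference is a perfect non-zero square. -}

module Defs where

open import Data.Nat using (ℕ; suc; _+_; _*_; _≤_)
open import Data.Fin using (Fin; toℕ)
open import Data.Fin.Subset using (Subset; _∈_; ∣_∣)
open import Data.Product using (∃-syntax; _×_)
open import Relation.Nullary using (¬_)

-- A subset S of {1,…,N} is encoded as a subset of Fin N; the element
-- x : Fin N stands for the integer  elem x = toℕ x + 1  ∈ {1,…,N}.
elem : ∀ {N} → Fin N → ℕ
elem x = suc (toℕ x)

-- S contains no two distinct elements whose difference is a perfect
-- non-zero square: there are no a, b ∈ S and k ≥ 1 with b = a + k².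
-- (Since k ≥ 1, a and b are automatically distinct; both orders of the
-- pair are covered because a, b range over all of S.)
SquareDifferenceFree : ∀ {N} → Subset N → Set
SquareDifferenceFree {N} S =
  ∀ {a b : Fin N} → a ∈ S → b ∈ S →
    ¬ (∃[ k ] (1 ≤ k × elem b ≡ elem a + k * k))
  where open import Relation.Binary.PropositionalEquality using (_≡_)

IsD : ℕ → ℕ → Set
IsD N d =
  (∃[ S ] (SquareDifferenceFree {N} S × ∣ S ∣ ≡ d)) ×
  (∀ (S : Subset N) → SquareDifferenceFree S → ∣ S ∣ ≤ d)
  where open import Relation.Binary.PropositionalEquality using (_≡_)

module Submission where

-- * Existence of D(N): the property is decidable, so a largest size of a
--   square-difference-free subset can be found by a bounded search.
-- * Upper bound: 0, 672², 680², 697² pairwise differ by non-zero squares,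
--   so the four translates of a square-difference-free S by these shifts
--   are pairwise disjoint subsets of [0, N + 697²); hence 4|S| ≤ N + 697².
--   This is proved for any list of shifts pairwise differing by squares.
-- * Lower bound: if S is square-difference-free then so is
--   {4a, 4a + 2 : a ∈ S} (squares are 0 or 1 mod 4), which doubles |S|
--   and quadruples the length.  Starting from explicit sets of lengths
--   8 to 31 this yields, for every L ≥ 8, a set with L + 1 ≤ |S|²;
--   small N are handled by explicit sets.

open import Defs
open import Data.Nat
  using (ℕ; zero; suc; _+_; _*_; _∸_; _≡ᵇ_; _≤_; _<_; _≤?_; _<?_; _≟_; z≤n; s≤s; s≤s⁻¹; >-nonZero)
open import Data.Nat.Properties
open import Data.Nat.DivMod
  using (_%_; _/_; [m+kn]%n≡m%n; m<n⇒m%n≡m; m≡m%n+[m/n]*n; m%n<n; m/n<m; /-mono-≤)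
open import Data.Nat.Induction using (<-rec)
open import Data.Nat.Tactic.RingSolver using (solve-∀)
open import Data.Bool using (Bool; true; false; if_then_else_; _∨_)
open import Data.Vec using (Vec; []; _∷_; replicate; tabulate)
open import Data.List using (List; []; _∷_; length; map)
open import Data.Nat.ListAction using (sum)
open import Data.List.Relation.Unary.All as All using (All; []; _∷_)
open import Data.List.Relation.Unary.AllPairs using (AllPairs; []; _∷_)
open import Data.Fin using (Fin; toℕ; fromℕ<)
open import Data.Fin.Properties using (any?; all?; toℕ-fromℕ<)
open import Data.Fin.Subset using (Subset; _∈_; ∣_∣; outside)
open import Data.Fin.Subset.Properties using (_∈?_; anySubset?; ∣p∣≤n)
open import Data.Vec using (here; there)
open import Data.Product using (∃-syntax; _×_; _,_)
open import Data.Sum using (_⊎_; inj₁; inj₂)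
open import Data.Empty using (⊥; ⊥-elim)
open import Data.Unit using (tt)
open import Relation.Binary.PropositionalEquality
open import Relation.Nullary using (Dec; yes; no; ¬_)
open import Relation.Nullary.Decidable using (True; toWitness; map′; ¬?; _×-dec_; _→-dec_)

variable
  n b L : ℕ

SquareAbove : ℕ → ℕ → Set
SquareAbove m n = ∃[ k ] (1 ≤ k × m ≡ n + k * k)


k≤k*k : ∀ k → k ≤ k * k
k≤k*k zero    = z≤n
k≤k*k (suc k) = m≤m*n (suc k) (suc k)

-- A witness k of SquareAbove m n satisfies k ≤ m, so a search over Fin (suc m) decides it.
squareAbove? : ∀ m n → Dec (SquareAbove m n)
squareAbove? m n =
  map′ toSquareAbove fromSquareAbove
    (any? λ (k : Fin (suc m)) → (1 ≤? toℕ k) ×-dec (m ≟ n + toℕ k * toℕ k))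
  where
  toSquareAbove : ∃[ k ] (1 ≤ toℕ k × m ≡ n + toℕ k * toℕ k) → SquareAbove m n
  toSquareAbove (k , 1≤k , eq) = toℕ k , 1≤k , eq

  fromSquareAbove : SquareAbove m n → ∃[ k ] (1 ≤ toℕ {suc m} k × m ≡ n + toℕ k * toℕ k)
  fromSquareAbove (k , 1≤k , eq) =
    fromℕ< k<1+m , subst (λ j → 1 ≤ j × m ≡ n + j * j) (sym (toℕ-fromℕ< k<1+m)) (1≤k , eq)
    where
    k<1+m : k < suc m
    k<1+m = s≤s (≤-trans (k≤k*k k) (≤-trans (m≤n+m (k * k) n) (≤-reflexive (sym eq))))

squareDifferenceFree? : (S : Subset n) → Dec (SquareDifferenceFree S)
squareDifferenceFree? S =
  map′ (λ f {a} {b} → f a b) (λ f a b → f {a} {b})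
    (all? λ a → all? λ b →
      (a ∈? S) →-dec ((b ∈? S) →-dec ¬? (squareAbove? (elem b) (elem a))))

largest : (P : ℕ → Set) → (∀ m → Dec (P m)) → P 0 →
          ∀ c → (∀ m → P m → m ≤ c) → ∃[ d ] (P d × (∀ m → P m → m ≤ d))
largest P P? P0 c bounded with P? c
... | yes Pc = c , Pc , bounded
largest P P? P0 zero    bounded | no ¬P0 = ⊥-elim (¬P0 P0)
largest P P? P0 (suc c) bounded | no ¬Pc = largest P P? P0 c below
  where
  below : ∀ m → P m → m ≤ c
  below m Pm with m≤n⇒m<n∨m≡n (bounded m Pm)
  ... | inj₁ m<1+c = s≤s⁻¹ m<1+c
  ... | inj₂ refl  = ⊥-elim (¬Pc Pm)

emptySet-free : SquareDifferenceFree (replicate n outside)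
emptySet-free a∈∅ _ _ = nothing-inside a∈∅
  where
  nothing-inside : ∀ {m} {x : Fin m} → ¬ x ∈ replicate m outside
  nothing-inside (there x∈∅) = nothing-inside x∈∅

∣emptySet∣ : ∀ n → ∣ replicate n outside ∣ ≡ 0
∣emptySet∣ zero    = refl
∣emptySet∣ (suc n) = ∣emptySet∣ n

maximum : ∀ N → ∃[ d ] IsD N d
maximum N with largest (HasSize N) hasSize? (replicate N outside , emptySet-free , ∣emptySet∣ N)
                       N (λ { _ (S , _ , refl) → ∣p∣≤n S })
  where
  HasSize : ℕ → ℕ → Set
  HasSize N m = ∃[ S ] (SquareDifferenceFree {N} S × ∣ S ∣ ≡ m)

  hasSize? : ∀ m → Dec (HasSize N m)
  hasSize? m = anySubset? λ S → squareDifferenceFree? S ×-dec (∣ S ∣ ≟ m)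
... | d , attained , maximal = d , attained , λ S free → maximal ∣ S ∣ (S , free , refl)


-- Membership of the 0-based position p; positions past the end are absent.
member : Vec Bool n → ℕ → Bool
member []      p       = false
member (x ∷ v) zero    = x
member (x ∷ v) (suc p) = member v p

∈⇒member : ∀ {S : Subset n} {x : Fin n} → x ∈ S → member S (toℕ x) ≡ true
∈⇒member here        = refl
∈⇒member (there x∈S) = ∈⇒member x∈S

member⇒∈ : (S : Subset n) → ∀ p → member S p ≡ true → ∃[ x ] (toℕ x ≡ p × x ∈ S)
member⇒∈ (true ∷ S)  zero    refl = Fin.zero , refl , here
member⇒∈ (x ∷ S)     (suc p) mem with member⇒∈ S p mem
... | y , refl , y∈S = Fin.suc y , refl , there y∈S

NoSquareGaps : Vec Bool n → Set
NoSquareGaps S = ∀ p k → 1 ≤ k → member S p ≡ true → member S (p + k * k) ≡ true → ⊥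

noSquareGaps⇒free : {S : Subset n} → NoSquareGaps S → SquareDifferenceFree S
noSquareGaps⇒free {S = S} gaps {a} a∈S b∈S (k , 1≤k , eq) =
  gaps (toℕ a) k 1≤k (∈⇒member a∈S)
    (subst (λ q → member S q ≡ true) (suc-injective eq) (∈⇒member b∈S))

free⇒noSquareGaps : {S : Subset n} → SquareDifferenceFree S → NoSquareGaps S
free⇒noSquareGaps {S = S} free p k 1≤k p∈S q∈S
  with member⇒∈ S p p∈S | member⇒∈ S (p + k * k) q∈S
... | x , refl , x∈S | y , y≡q , y∈S = free x∈S y∈S (k , 1≤k , cong suc y≡q)

checked : (S : Subset n) {_ : True (squareDifferenceFree? S)} → NoSquareGaps S
checked S {ok} = free⇒noSquareGaps (toWitness ok)


Σ< : ℕ → (ℕ → ℕ) → ℕ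
Σ< zero    f = 0
Σ< (suc L) f = f 0 + Σ< L (λ u → f (suc u))

Σ<-zero : ∀ L {f} → (∀ u → f u ≡ 0) → Σ< L f ≡ 0
Σ<-zero zero    f≡0 = refl
Σ<-zero (suc L) f≡0 = cong₂ _+_ (f≡0 0) (Σ<-zero L (λ u → f≡0 (suc u)))

Σ<-+ : ∀ L f g → Σ< L (λ u → f u + g u) ≡ Σ< L f + Σ< L g
Σ<-+ zero    f g = refl
Σ<-+ (suc L) f g = begin
  f 0 + g 0 + Σ< L (λ u → f (suc u) + g (suc u))
    ≡⟨ cong (f 0 + g 0 +_) (Σ<-+ L (λ u → f (suc u)) (λ u → g (suc u))) ⟩
  f 0 + g 0 + (Σ< L (λ u → f (suc u)) + Σ< L (λ u → g (suc u)))
    ≡⟨ interchange (f 0) (g 0) _ _ ⟩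
  f 0 + Σ< L (λ u → f (suc u)) + (g 0 + Σ< L (λ u → g (suc u))) ∎
  where
  open ≡-Reasoning
  interchange : ∀ a b c d → a + b + (c + d) ≡ a + c + (b + d)
  interchange = solve-∀

Σ<-≤ : ∀ L f → (∀ u → f u ≤ 1) → Σ< L f ≤ L
Σ<-≤ zero    f f≤1 = z≤n
Σ<-≤ (suc L) f f≤1 = +-mono-≤ (f≤1 0) (Σ<-≤ L (λ u → f (suc u)) (λ u → f≤1 (suc u)))

-- Indicator of the translate e + S of S, as a function of the position.
translate : ℕ → Vec Bool n → ℕ → ℕ
translate zero    S u       = if member S u then 1 else 0
translate (suc e) S zero    = 0
translate (suc e) S (suc u) = translate e S u

translate-view : ∀ e (S : Vec Bool n) u →
  translate e S u ≡ 0 ⊎ (translate e S u ≡ 1 × ∃[ p ] (u ≡ e + p × member S p ≡ true))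
translate-view zero S u with member S u in mem
... | true  = inj₂ (refl , u , refl , mem)
... | false = inj₁ refl
translate-view (suc e) S zero    = inj₁ refl
translate-view (suc e) S (suc u) with translate-view e S u
... | inj₁ none                    = inj₁ none
... | inj₂ (one , p , refl , p∈S) = inj₂ (one , p , refl , p∈S)

Σ<-translate : ∀ e (S : Vec Bool n) c → Σ< (e + (n + c)) (translate e S) ≡ ∣ S ∣
Σ<-translate (suc e) S       c = Σ<-translate e S c
Σ<-translate zero    []      c = Σ<-zero c (λ _ → refl)
Σ<-translate zero (true ∷ S)  c = cong suc (Σ<-translate zero S c)
Σ<-translate zero (false ∷ S) c = Σ<-translate zero S c

translates-disjoint : {S : Vec Bool n} → NoSquareGaps S → ∀ {e e' p u} →
  SquareAbove e e' → u ≡ e + p → member S p ≡ true → translate e' S u ≡ 0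
translates-disjoint {S = S} gaps {e} {e'} {p} {u} (k , 1≤k , e≡e'+k²) u≡e+p p∈S
  with translate-view e' S u
... | inj₁ none                       = none
... | inj₂ (_ , p' , u≡e'+p' , p'∈S) =
  ⊥-elim (gaps p k 1≤k p∈S (subst (λ q → member S q ≡ true) p'≡p+k² p'∈S))
  where
  open ≡-Reasoning
  p'≡p+k² : p' ≡ p + k * k
  p'≡p+k² = +-cancelˡ-≡ e' p' (p + k * k) (begin
    e' + p'          ≡⟨ trans (sym u≡e'+p') u≡e+p ⟩
    e + p            ≡⟨ cong (_+ p) e≡e'+k² ⟩
    e' + k * k + p   ≡⟨ +-assoc e' (k * k) p ⟩
    e' + (k * k + p) ≡⟨ cong (e' +_) (+-comm (k * k) p) ⟩
    e' + (p + k * k) ∎)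

coverage : List ℕ → Vec Bool n → ℕ → ℕ
coverage es S u = sum (map (λ e → translate e S u) es)

coverage-zero : (S : Vec Bool n) → ∀ {es u} → All (λ e → translate e S u ≡ 0) es →
  coverage es S u ≡ 0
coverage-zero S []            = refl
coverage-zero S (none ∷ rest) = cong₂ _+_ none (coverage-zero S rest)

coverage≤1 : {S : Vec Bool n} → NoSquareGaps S → ∀ {es} →
  AllPairs SquareAbove es → ∀ u → coverage es S u ≤ 1
coverage≤1 gaps [] u = z≤n
coverage≤1 {S = S} gaps {e ∷ es} (above ∷ pairs) u with translate-view e S u
... | inj₁ none = subst (λ t → t + coverage es S u ≤ 1) (sym none) (coverage≤1 gaps pairs u)
... | inj₂ (one , p , u≡e+p , p∈S) = begin
  translate e S u + coverage es S u ≡⟨ cong₂ _+_ one rest-empty ⟩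
  1                                 ∎
  where
  open ≤-Reasoning
  rest-empty : coverage es S u ≡ 0
  rest-empty = coverage-zero S (All.map (λ sq → translates-disjoint gaps sq u≡e+p p∈S) above)

Σ<-coverage : (S : Vec Bool n) → ∀ M es → All (_≤ M) es →
  Σ< (n + M) (coverage es S) ≡ length es * ∣ S ∣
Σ<-coverage {n} S M []       []          = Σ<-zero (n + M) (λ _ → refl)
Σ<-coverage {n} S M (e ∷ es) (e≤M ∷ rest) = begin
  Σ< (n + M) (λ u → translate e S u + coverage es S u)
    ≡⟨ Σ<-+ (n + M) (translate e S) (coverage es S) ⟩
  Σ< (n + M) (translate e S) + Σ< (n + M) (coverage es S)
    ≡⟨ cong₂ _+_ translate-count (Σ<-coverage S M es rest) ⟩
  ∣ S ∣ + length es * ∣ S ∣ ∎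
  where
  open ≡-Reasoning
  length-split : n + M ≡ e + (n + (M ∸ e))
  length-split = begin
    n + M           ≡⟨ cong (n +_) (sym (m+[n∸m]≡n e≤M)) ⟩
    n + (e + (M ∸ e)) ≡⟨ x+[y+z]≡y+[x+z] n e (M ∸ e) ⟩
    e + (n + (M ∸ e)) ∎
    where
    x+[y+z]≡y+[x+z] : ∀ x y z → x + (y + z) ≡ y + (x + z)
    x+[y+z]≡y+[x+z] = solve-∀
  translate-count : Σ< (n + M) (translate e S) ≡ ∣ S ∣
  translate-count = trans (cong (λ l → Σ< l (translate e S)) length-split)
                          (Σ<-translate e S (M ∸ e))

translates-bound : {S : Vec Bool n} → NoSquareGaps S → ∀ {m es} →
  AllPairs SquareAbove (m ∷ es) → length (m ∷ es) * ∣ S ∣ ≤ n + m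
translates-bound {n} {S} gaps {m} {es} pairs@(above ∷ _) = begin
  length (m ∷ es) * ∣ S ∣     ≡⟨ sym (Σ<-coverage S m (m ∷ es) (≤-refl ∷ below)) ⟩
  Σ< (n + m) (coverage (m ∷ es) S) ≤⟨ Σ<-≤ (n + m) _ (coverage≤1 gaps pairs) ⟩
  n + m                        ∎
  where
  open ≤-Reasoning
  below : All (_≤ m) es
  below = All.map (λ { (k , _ , refl) → m≤m+n _ (k * k) }) above

-- The shifts 697² > 680² > 672² > 0 pairwise differ by squares:
-- 697² - 680² = 153², 697² - 672² = 185², 680² - 672² = 104².
shifts : List ℕ
shifts = 697 * 697 ∷ 680 * 680 ∷ 672 * 672 ∷ 0 ∷ []

shifts-square-apart : AllPairs SquareAbove shifts
shifts-square-apart =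
  ((153 , s≤s z≤n , refl) ∷ (185 , s≤s z≤n , refl) ∷ (697 , s≤s z≤n , refl) ∷ []) ∷
  ((104 , s≤s z≤n , refl) ∷ (680 , s≤s z≤n , refl) ∷ []) ∷
  ((672 , s≤s z≤n , refl) ∷ []) ∷
  [] ∷ []

upper-bound : ∀ {N d} → IsD N d → 4 * d ≤ N + 543443
upper-bound {N} ((S , free , refl) , _) =
  ≤-trans (translates-bound {S = S} (free⇒noSquareGaps free) shifts-square-apart)
          (+-monoʳ-≤ N (m≤m+n (697 * 697) 57634))


padTo : b ≤ L → Vec Bool b → Vec Bool L
padTo {L = L} z≤n       []      = replicate L false
padTo         (s≤s b≤L) (x ∷ v) = x ∷ padTo b≤L v

member-padTo : (b≤L : b ≤ L) (v : Vec Bool b) → ∀ p →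
  member (padTo b≤L v) p ≡ true → member v p ≡ true
member-padTo {L = L} z≤n []    p       = λ mem → ⊥-elim (absent L p mem)
  where
  absent : ∀ L p → ¬ member (replicate L false) p ≡ true
  absent (suc L) zero    ()
  absent (suc L) (suc p) mem = absent L p mem
member-padTo (s≤s b≤L) (x ∷ v) zero    mem = mem
member-padTo (s≤s b≤L) (x ∷ v) (suc p) mem = member-padTo b≤L v p mem

∣padTo∣ : (b≤L : b ≤ L) (v : Vec Bool b) → ∣ padTo b≤L v ∣ ≡ ∣ v ∣
∣padTo∣ {L = L} z≤n []          = ∣emptySet∣ L
∣padTo∣ (s≤s b≤L) (true ∷ v)  = cong suc (∣padTo∣ b≤L v)
∣padTo∣ (s≤s b≤L) (false ∷ v) = ∣padTo∣ b≤L v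

padTo-free : (b≤L : b ≤ L) {v : Vec Bool b} → NoSquareGaps v → NoSquareGaps (padTo b≤L v)
padTo-free b≤L {v} gaps p k 1≤k p∈ q∈ =
  gaps p k 1≤k (member-padTo b≤L v p p∈) (member-padTo b≤L v (p + k * k) q∈)

-- The set {4a, 4a + 2 : a ∈ S}.
scale : Vec Bool n → Vec Bool (n * 4)
scale []      = []
scale (x ∷ v) = x ∷ false ∷ x ∷ false ∷ scale v

∣scale∣ : (v : Vec Bool n) → ∣ scale v ∣ ≡ ∣ v ∣ + ∣ v ∣
∣scale∣ []          = refl
∣scale∣ (true ∷ v)  = cong suc (trans (cong suc (∣scale∣ v)) (sym (+-suc ∣ v ∣ ∣ v ∣)))
∣scale∣ (false ∷ v) = ∣scale∣ v

data Offset : ℕ → Set where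
  offset0 : Offset 0
  offset2 : Offset 2

offset<3 : ∀ {t} → Offset t → t < 3
offset<3 offset0 = s≤s z≤n
offset<3 offset2 = s≤s (s≤s (s≤s z≤n))

offset<4 : ∀ {t} → Offset t → t < 4
offset<4 off = m<n⇒m<1+n (offset<3 off)

offset-parity : ∀ {t t'} → Offset t → Offset t' → ¬ suc t ≡ t'
offset-parity offset0 offset0 ()
offset-parity offset0 offset2 ()
offset-parity offset2 offset0 ()
offset-parity offset2 offset2 ()

member-scale : (v : Vec Bool n) → ∀ q → member (scale v) q ≡ true →
  ∃[ t ] ∃[ a ] (Offset t × q ≡ t + a * 4 × member v a ≡ true)
member-scale (x ∷ v) 0 mem = 0 , 0 , offset0 , refl , mem
member-scale (x ∷ v) 2 mem = 2 , 0 , offset2 , refl , mem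
member-scale (x ∷ v) (suc (suc (suc (suc q)))) mem with member-scale v q mem
... | t , a , off , refl , a∈v = t , suc a , off , next-block t a , a∈v
  where
  next-block : ∀ t a → 4 + (t + a * 4) ≡ t + suc a * 4
  next-block = solve-∀

residue-unique : ∀ {r r'} x y → r < 4 → r' < 4 → r + x * 4 ≡ r' + y * 4 → r ≡ r'
residue-unique {r} {r'} x y r<4 r'<4 eq = begin
  r                ≡⟨ sym (m<n⇒m%n≡m r<4) ⟩
  r % 4            ≡⟨ sym ([m+kn]%n≡m%n r x 4) ⟩
  (r + x * 4) % 4  ≡⟨ cong (_% 4) eq ⟩
  (r' + y * 4) % 4 ≡⟨ [m+kn]%n≡m%n r' y 4 ⟩
  r' % 4           ≡⟨ m<n⇒m%n≡m r'<4 ⟩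
  r'               ∎
  where open ≡-Reasoning

parity : ∀ k → ∃[ m ] (k ≡ m + m ⊎ k ≡ suc (m + m))
parity zero = 0 , inj₁ refl
parity (suc k) with parity k
... | m , inj₁ refl = m , inj₂ refl
... | m , inj₂ refl = suc m , inj₁ (cong suc (sym (+-suc m m)))

-- A square gap between members of the scaled set comes from a square gap in
-- S: odd squares are 1 mod 4, so they cannot join two offsets, and an even
-- square (2m)² = 4m² yields the gap m² between the underlying members.
scaled-gap : ∀ {t t' a a' k} → Offset t → Offset t' → 1 ≤ k →
  t + a * 4 + k * k ≡ t' + a' * 4 → ∃[ m ] (1 ≤ m × a' ≡ a + m * m)
scaled-gap {t} {t'} {a} {a'} {k} off off' 1≤k eq with parity k
... | m , inj₂ refl =
  ⊥-elim (offset-parity off off'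
    (residue-unique (a + m * m + m) a' (s≤s (offset<3 off)) (offset<4 off') odd-square))
  where
  odd-expansion : ∀ t a m → t + a * 4 + suc (m + m) * suc (m + m) ≡ suc t + (a + m * m + m) * 4
  odd-expansion = solve-∀
  odd-square : suc t + (a + m * m + m) * 4 ≡ t' + a' * 4
  odd-square = trans (sym (odd-expansion t a m)) eq
... | m , inj₁ refl = m , positive m 1≤k , sym (*-cancelʳ-≡ (a + m * m) a' 4 blocks-equal)
  where
  positive : ∀ m → 1 ≤ m + m → 1 ≤ m
  positive (suc m) _ = s≤s z≤n
  even-expansion : ∀ t a m → t + a * 4 + (m + m) * (m + m) ≡ t + (a + m * m) * 4
  even-expansion = solve-∀
  even-square : t + (a + m * m) * 4 ≡ t' + a' * 4
  even-square = trans (sym (even-expansion t a m)) eq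
  same-offset : t ≡ t'
  same-offset = residue-unique (a + m * m) a' (offset<4 off) (offset<4 off') even-square
  blocks-equal : (a + m * m) * 4 ≡ a' * 4
  blocks-equal = +-cancelˡ-≡ t _ _ (trans even-square (cong (_+ a' * 4) (sym same-offset)))

scale-free : {v : Vec Bool n} → NoSquareGaps v → NoSquareGaps (scale v)
scale-free {v = v} gaps p k 1≤k p∈ q∈
  with member-scale v p p∈ | member-scale v (p + k * k) q∈
... | t , a , off , refl , a∈v | t' , a' , off' , eq , a'∈v
  with scaled-gap {a = a} {a' = a'} off off' 1≤k eq
... | m , 1≤m , a'≡a+m² = gaps a m 1≤m a∈v (subst (λ c → member v c ≡ true) a'≡a+m² a'∈v)

-- A square-difference-free set of length L which is large: L + 1 ≤ |S|².
-- Largeness is the invariant preserved by the doubling construction.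
record Large (L : ℕ) : Set where
  constructor large
  field
    set  : Vec Bool L
    free : NoSquareGaps set
    big  : L + 1 ≤ ∣ set ∣ * ∣ set ∣

large-from : (B : Vec Bool b) → NoSquareGaps B → b ≤ L → L + 1 ≤ ∣ B ∣ * ∣ B ∣ → Large L
large-from {L = L} B gaps b≤L big =
  large (padTo b≤L B) (padTo-free b≤L gaps)
        (subst (λ s → L + 1 ≤ s * s) (sym (∣padTo∣ b≤L B)) big)

-- The doubling step: 4L + r + 1 ≤ 4(L + 1) ≤ 4|S|² = (2|S|)².
large-step : ∀ r → r < 4 → Large L → Large (L * 4 + r)
large-step {L} r r<4 (large S gaps big) =
  large-from (scale S) (scale-free {v = S} gaps) (m≤m+n (L * 4) r)
    (subst (λ s → L * 4 + r + 1 ≤ s * s) (sym (∣scale∣ S)) quadrupled)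
  where
  open ≤-Reasoning
  s = ∣ S ∣
  quadrupled : L * 4 + r + 1 ≤ (s + s) * (s + s)
  quadrupled = begin
    L * 4 + r + 1   ≡⟨ +-assoc (L * 4) r 1 ⟩
    L * 4 + (r + 1) ≤⟨ +-monoʳ-≤ (L * 4) (≤-trans (≤-reflexive (+-comm r 1)) r<4) ⟩
    L * 4 + 4       ≡⟨ times-four-succ L ⟩
    (L + 1) * 4     ≤⟨ *-monoˡ-≤ 4 big ⟩
    s * s * 4       ≡⟨ square-double s ⟩
    (s + s) * (s + s) ∎
    where
    times-four-succ : ∀ L → L * 4 + 4 ≡ (L + 1) * 4
    times-four-succ = solve-∀
    square-double : ∀ s → s * s * 4 ≡ (s + s) * (s + s)
    square-double = solve-∀

-- The positions ≡ 0, 2 (mod 5), i.e. the integers ≡ 1, 3 (mod 5): for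
-- lengths below 26 their differences are ±2 mod 5 or among 5, 10, 15, 20,
-- never squares.
residues : ∀ n → Vec Bool n
residues n = tabulate (λ i → (toℕ i % 5 ≡ᵇ 0) ∨ (toℕ i % 5 ≡ᵇ 2))

-- Large sets of lengths 8 to 31, padded from residues 8, 11 and 13
-- (of sizes 4, 5 and 6).
large-base : 8 ≤ L → L < 32 → Large L
large-base {L} 8≤L L<32 with L ≤? 15 | L ≤? 24
... | yes L≤15 | _ =
  large-from (residues 8) (checked (residues 8)) 8≤L (+-monoˡ-≤ 1 L≤15)
... | no L≰15 | yes L≤24 =
  large-from (residues 11) (checked (residues 11)) (≤-trans (≤ᵇ⇒≤ 11 16 tt) (≰⇒> L≰15))
    (+-monoˡ-≤ 1 L≤24)
... | no _ | no L≰24 =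
  large-from (residues 13) (checked (residues 13)) (≤-trans (≤ᵇ⇒≤ 13 25 tt) (≰⇒> L≰24))
    (≤-trans (≤-reflexive (+-comm L 1)) (≤-trans L<32 (≤ᵇ⇒≤ 32 36 tt)))

-- Every length L ≥ 8 admits a large set: write L = 4⌊L/4⌋ + (L mod 4) and
-- apply the doubling step to ⌊L/4⌋ until reaching [8, 32).
large-all : ∀ L → 8 ≤ L → Large L
large-all = <-rec (λ L → 8 ≤ L → Large L) λ L smaller 8≤L → split L (L <? 32) 8≤L smaller
  where
  split : ∀ L → Dec (L < 32) → 8 ≤ L → (∀ {m} → m < L → 8 ≤ m → Large m) → Large L
  split L (yes L<32) 8≤L smaller = large-base 8≤L L<32
  split L (no L≮32)  8≤L smaller =
    subst Large (trans (+-comm _ (L % 4)) (sym (m≡m%n+[m/n]*n L 4)))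
      (large-step (L % 4) (m%n<n L 4) (smaller quotient<L 8≤quotient))
    where
    instance
      L-nonZero = >-nonZero (≤-trans (s≤s z≤n) 8≤L)
    quotient<L : L / 4 < L
    quotient<L = m/n<m L 4 (s≤s (s≤s z≤n))
    8≤quotient : 8 ≤ L / 4
    8≤quotient = /-mono-≤ {m = 32} {n = L} (≮⇒≥ L≮32) (≤-refl {4})

Witness : ℕ → Set
Witness N = ∃[ S ] (NoSquareGaps {N} S × N ≤ suc ∣ S ∣ * suc ∣ S ∣)

witness-from : (B : Vec Bool b) → NoSquareGaps B → b ≤ L → L ≤ suc ∣ B ∣ * suc ∣ B ∣ → Witness L
witness-from {L = L} B gaps b≤L bound =
  padTo b≤L B , padTo-free b≤L gaps ,
  subst (λ s → L ≤ suc s * suc s) (sym (∣padTo∣ b≤L B)) bound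

large⇒witness : Large L → Witness L
large⇒witness {L} (large S gaps big) =
  S , gaps , ≤-trans (m≤n+m L 1) (≤-trans (≤-reflexive (+-comm 1 L))
                (≤-trans big (*-mono-≤ (n≤1+n ∣ S ∣) (n≤1+n ∣ S ∣))))

witness : ∀ N → Witness N
witness N with N ≤? 1 | N ≤? 4 | N ≤? 7
... | yes N≤1 | _       | _       = witness-from [] (λ _ _ _ ()) z≤n N≤1
... | no N≰1  | yes N≤4 | _       =
  witness-from (residues 1) (checked (residues 1)) (<⇒≤ (≰⇒> N≰1)) N≤4
... | no _    | no N≰4  | yes N≤7 =
  witness-from (residues 3) (checked (residues 3)) (≤-trans (≤ᵇ⇒≤ 3 5 tt) (≰⇒> N≰4))
    (≤-trans N≤7 (≤ᵇ⇒≤ 7 9 tt))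
... | no _    | no _    | no N≰7  = large⇒witness (large-all N (≰⇒> N≰7))

lower-bound : ∀ {N d} → IsD N d → N ≤ suc d * suc d
lower-bound {N} {d} (_ , maximal) with witness N
... | S , gaps , bound = ≤-trans bound (*-mono-≤ (s≤s |S|≤d) (s≤s |S|≤d))
  where
  |S|≤d : ∣ S ∣ ≤ d
  |S|≤d = maximal S (noSquareGaps⇒free gaps)

mainTheorem6 : ∀ (N : ℕ) →
    ∃[ d ] (IsD N d × (N ≤ suc d * suc d) × (4 * d ≤ N + 543443))
mainTheorem6 N with maximum N
... | d , isD = d , isD , lower-bound isD , upper-bound isD
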